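{- Let $n\ge 2$, let $0\le \alpha_1<\alpha_2<\dots<\alpha_n$ be integers and $x_1,\dots,x_n$ positive integers, and put $p_k=\sum_{i=1}^k x_i$, $q_k=\sum_{i=1}^k \alpha_i x_i$. Suppose that the non-decreasing sequence consisting of $\alpha_1$ repeated $x_1$ times, $\alpha_2$ repeated $x_2$ times, ..., $\alpha_n$ repeated $x_n$ times is the score sequence (sequence of out-degrees) of some tournament. Then for every $k\in\{1,\dots,n\}$, $$p_k\le 2\alpha_k+1\qquad\text{and}\qquad q_k\le \alpha_k(2\alpha_k+1).$$
   Context: A tournament is a directed graph obtained by orienting each edge of a complete graph; its score sequence is the sequence of out-degrees of its vertices. -}

module Defs where

open import Data.Nat using (ℕ; zero; suc; _+_; _*_; _<_; _≤_)
open import Data.Bool using (Bool; true; false; T; not)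
open import Data.Fin using (Fin; toℕ)
open import Data.List using (List; []; _∷_; length; replicate; concatMap; lookup; map; filter)
open import Data.Nat.ListAction using (sum)
open import Data.Nat using (_≤?_)
open import Data.Bool.Properties using (T?)
open import Data.List.Base using (allFin)
open import Data.Vec.Functional using (Vector)
open import Data.Fin.Properties using () renaming (_≟_ to _≟ᶠ_)
open import Data.Product using (Σ; _×_; ∃-syntax)
open import Relation.Binary.PropositionalEquality using (_≡_; _≢_)
open import Relation.Nullary.Decidable using (⌊_⌋)

record Tournament (m : ℕ) : Set where
  field
    beats   : Fin m → Fin m → Bool
    irrefl  : ∀ i → beats i i ≡ false
    oriented : ∀ i j → i ≢ j → beats j i ≡ not (beats i j)

open Tournament public

count : ∀ {m} → (Fin m → Bool) → ℕ
count {m} P = length (filter (λ j → T? (P j)) (allFin m))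

score : ∀ {m} → Tournament m → Fin m → ℕ
score t i = count (beats t i)

IsScoreSequence : List ℕ → Set
IsScoreSequence s = Σ (Tournament (length s)) (λ t → ∀ i → score t i ≡ lookup s i)

expand : ∀ {n} → (α x : Fin n → ℕ) → List ℕ
expand {n} α x = concatMap (λ i → replicate (x i) (α i)) (allFin n)

-- Σ_{i ≤ k} f i  (indices 0-based: k : Fin n stands for the paper's k+1)
sumUpTo : ∀ {n} → (Fin n → ℕ) → Fin n → ℕ
sumUpTo {n} f k = sum (map f (filter (λ i → toℕ i ≤? toℕ k) (allFin n)))

p : ∀ {n} → (x : Fin n → ℕ) → Fin n → ℕ
p x = sumUpTo x

q : ∀ {n} → (α x : Fin n → ℕ) → Fin n → ℕ
q α x = sumUpTo (λ i → α i * x i)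

{-# OPTIONS --safe #-}
module Submission where

-- The c vertices of score at most a span a subtournament whose c(c-1)/2
-- arcs are each counted in the score of one of them, so c(c-1)/2 ≤ c a, i.e. c ≤ 2a+1.
-- As α is increasing, the entries α_1, …, α_k of the score sequence (p_k of them) are all
-- at most α_k, so p_k ≤ c for a = α_k; finally q_k ≤ α_k p_k.

open import Defs
open import Data.Nat using (ℕ; zero; suc; _+_; _*_; _<_; _≤_; z≤n; _≤?_)
open import Data.Nat.Properties
open import Algebra.Properties.CommutativeSemigroup +-commutativeSemigroup using (x∙yz≈y∙xz)
open import Data.Nat.Combinatorics using (_C_; nC1≡n; nCk+nC[k+1]≡[n+1]C[k+1])
open import Data.Nat.ListAction using (sum)
open import Data.Nat.Tactic.RingSolver using (solve-∀)
open import Data.Bool using (true; false)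
open import Data.Bool.Properties using (T?)
open import Data.Fin using (Fin; toℕ) renaming (_<_ to _<ᶠ_; _≤_ to _≤ᶠ_)
open import Data.Fin.Properties using (toℕ-injective)
open import Data.List using (List; []; _∷_; length; replicate; concatMap; lookup; map; filter; allFin)
open import Data.List.Properties
  using (filter-++; filter-all; filter-none; length-++; length-replicate; map-tabulate; tabulate-lookup)
open import Data.List.Relation.Unary.All as All using (All; []; _∷_)
open import Data.List.Relation.Unary.All.Properties using (all-filter; replicate⁺)
open import Data.List.Relation.Unary.AllPairs using ([]; _∷_)
open import Data.List.Relation.Unary.Unique.Propositional using (Unique)
import Data.List.Relation.Unary.Unique.Propositional.Properties as Unique
open import Data.List.Relation.Binary.Sublist.Propositional using (_⊆_; []; _∷_; _∷ʳ_; ⊆-refl)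
open import Data.List.Relation.Binary.Sublist.Propositional.Properties using (filter⁺; filter-⊆; length-mono-≤)
open import Data.Product using (_×_; _,_)
open import Data.Sum using (inj₁; inj₂)
open import Function using (id; _∘_)
open import Level using (Level)
open import Relation.Binary.PropositionalEquality
open import Relation.Nullary using (yes; no; does)
open import Relation.Unary using (Pred; Decidable)

private variable
  ℓ : Level
  A B : Set

sum-map-mono-⊆ : (f : A → ℕ) {xs ys : List A} → xs ⊆ ys → sum (map f xs) ≤ sum (map f ys)
sum-map-mono-⊆ f []             = z≤n
sum-map-mono-⊆ f (y ∷ʳ xs⊆ys)   = ≤-trans (sum-map-mono-⊆ f xs⊆ys) (m≤n+m _ (f y))
sum-map-mono-⊆ f (refl ∷ xs⊆ys) = +-monoʳ-≤ _ (sum-map-mono-⊆ f xs⊆ys)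

sum-map-≤-length : {f : A → ℕ} {a : ℕ} {xs : List A} →
                   All (λ i → f i ≤ a) xs → sum (map f xs) ≤ length xs * a
sum-map-≤-length []           = z≤n
sum-map-≤-length (fi≤a ∷ f≤a) = +-mono-≤ fi≤a (sum-map-≤-length f≤a)

sum-map-*-≤ : (f g : A → ℕ) {a : ℕ} {xs : List A} →
              All (λ i → f i ≤ a) xs → sum (map (λ i → f i * g i) xs) ≤ a * sum (map g xs)
sum-map-*-≤ f g [] = z≤n
sum-map-*-≤ f g {a} {i ∷ xs} (fi≤a ∷ f≤a) = begin
  f i * g i + sum (map (λ j → f j * g j) xs) ≤⟨ +-mono-≤ (*-monoˡ-≤ (g i) fi≤a) (sum-map-*-≤ f g f≤a) ⟩
  a * g i + a * sum (map g xs)               ≡⟨ *-distribˡ-+ a (g i) _ ⟨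
  a * (g i + sum (map g xs))                 ∎
  where open ≤-Reasoning

length-filter-map : {P : Pred B ℓ} (P? : Decidable P) (f : A → B) (xs : List A) →
                    length (filter P? (map f xs)) ≡ length (filter (P? ∘ f) xs)
length-filter-map P? f []       = refl
length-filter-map P? f (x ∷ xs) with does (P? (f x))
... | true  = cong suc (length-filter-map P? f xs)
... | false = length-filter-map P? f xs

length-filter-lookup : {P : Pred A ℓ} (P? : Decidable P) (xs : List A) →
                       length (filter (P? ∘ lookup xs) (allFin (length xs))) ≡ length (filter P? xs)
length-filter-lookup P? xs = begin
  length (filter (P? ∘ lookup xs) (allFin (length xs)))
    ≡⟨ length-filter-map P? (lookup xs) (allFin (length xs)) ⟨
  length (filter P? (map (lookup xs) (allFin (length xs))))
    ≡⟨ cong (length ∘ filter P?) map-lookup-allFin ⟩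
  length (filter P? xs)
    ∎
  where
  open ≡-Reasoning
  map-lookup-allFin : map (lookup xs) (allFin (length xs)) ≡ xs
  map-lookup-allFin = trans (map-tabulate id (lookup xs)) (tabulate-lookup xs)

length-filter-concatMap-replicate :
  {P : Pred ℕ ℓ} (P? : Decidable P) (α x : A → ℕ) (is : List A) →
  length (filter P? (concatMap (λ i → replicate (x i) (α i)) is)) ≡ sum (map x (filter (P? ∘ α) is))
length-filter-concatMap-replicate P? α x [] = refl
length-filter-concatMap-replicate P? α x (i ∷ is)
  rewrite filter-++ P? (replicate (x i) (α i)) (concatMap (λ j → replicate (x j) (α j)) is)
        | length-++ (filter P? (replicate (x i) (α i)))
                    {filter P? (concatMap (λ j → replicate (x j) (α j)) is)}
  with P? (α i)
... | yes Pαi = cong₂ _+_ (trans (cong length (filter-all P? (replicate⁺ (x i) Pαi)))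
                                 (length-replicate (x i)))
                          (length-filter-concatMap-replicate P? α x is)
... | no ¬Pαi = trans (cong (λ l → length l + _) (filter-none P? (replicate⁺ (x i) ¬Pαi)))
                      (length-filter-concatMap-replicate P? α x is)

2*nC2+n≡n*n : ∀ n → 2 * (n C 2) + n ≡ n * n
2*nC2+n≡n*n zero    = refl
2*nC2+n≡n*n (suc n) = begin
  2 * (suc n C 2) + suc n         ≡⟨ cong (λ c → 2 * c + suc n) (nCk+nC[k+1]≡[n+1]C[k+1] n 1) ⟨
  2 * (n C 1 + n C 2) + suc n     ≡⟨ cong (λ c → 2 * (c + n C 2) + suc n) (nC1≡n n) ⟩
  2 * (n + n C 2) + suc n         ≡⟨ regroup n (n C 2) ⟩
  (2 * (n C 2) + n) + (2 * n + 1) ≡⟨ cong (_+ (2 * n + 1)) (2*nC2+n≡n*n n) ⟩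
  n * n + (2 * n + 1)             ≡⟨ square-suc n ⟩
  suc n * suc n                   ∎
  where
  open ≡-Reasoning
  regroup : ∀ n c → 2 * (n + c) + suc n ≡ (2 * c + n) + (2 * n + 1)
  regroup = solve-∀
  square-suc : ∀ n → n * n + (2 * n + 1) ≡ suc n * suc n
  square-suc = solve-∀

nC2≤n*a⇒n≤2a+1 : ∀ n a → n C 2 ≤ n * a → n ≤ 2 * a + 1
nC2≤n*a⇒n≤2a+1 zero      a _       = z≤n
nC2≤n*a⇒n≤2a+1 n@(suc _) a nC2≤na = *-cancelˡ-≤ n (begin
  n * n             ≡⟨ 2*nC2+n≡n*n n ⟨
  2 * (n C 2) + n   ≤⟨ +-monoˡ-≤ n (*-monoʳ-≤ 2 nC2≤na) ⟩
  2 * (n * a) + n   ≡⟨ factor n a ⟩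
  n * (2 * a + 1)   ∎)
  where
  open ≤-Reasoning
  factor : ∀ n a → 2 * (n * a) + n ≡ n * (2 * a + 1)
  factor = solve-∀

module _ {m : ℕ} (t : Tournament m) where

  winsIn : List (Fin m) → Fin m → ℕ
  winsIn L i = length (filter (λ j → T? (beats t i j)) L)

  lossesIn : List (Fin m) → Fin m → ℕ
  lossesIn L j = length (filter (λ i → T? (beats t i j)) L)

  winsIn-mono-⊆ : ∀ i {L L′} → L ⊆ L′ → winsIn L i ≤ winsIn L′ i
  winsIn-mono-⊆ i L⊆L′ = length-mono-≤ (filter⁺ _ _ (λ { refl → id }) L⊆L′)

  winsIn-∷-self : ∀ a L → winsIn (a ∷ L) a ≡ winsIn L a
  winsIn-∷-self a L rewrite irrefl t a = refl

  sum-winsIn-∷ : ∀ a L M → sum (map (winsIn (a ∷ L)) M) ≡ lossesIn M a + sum (map (winsIn L) M)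
  sum-winsIn-∷ a L []      = refl
  sum-winsIn-∷ a L (i ∷ M) with beats t i a
  ... | true  = cong suc (trans (cong (winsIn L i +_) (sum-winsIn-∷ a L M))
                                (x∙yz≈y∙xz (winsIn L i) (lossesIn M a) _))
  ... | false = trans (cong (winsIn L i +_) (sum-winsIn-∷ a L M))
                      (x∙yz≈y∙xz (winsIn L i) (lossesIn M a) _)

  winsIn+lossesIn : ∀ a L → All (a ≢_) L → winsIn L a + lossesIn L a ≡ length L
  winsIn+lossesIn a []      []            = refl
  winsIn+lossesIn a (j ∷ L) (a≢j ∷ a∉L) rewrite oriented t a j a≢j with beats t a j
  ... | true  = cong suc (winsIn+lossesIn a L a∉L)
  ... | false = trans (+-suc _ _) (cong suc (winsIn+lossesIn a L a∉L))

  sum-winsIn≡C2 : ∀ L → Unique L → sum (map (winsIn L) L) ≡ length L C 2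
  sum-winsIn≡C2 []      []           = refl
  sum-winsIn≡C2 (a ∷ L) (a∉L ∷ uniq) = begin
    winsIn (a ∷ L) a + sum (map (winsIn (a ∷ L)) L)
      ≡⟨ cong₂ _+_ (winsIn-∷-self a L) (sum-winsIn-∷ a L L) ⟩
    winsIn L a + (lossesIn L a + sum (map (winsIn L) L))
      ≡⟨ +-assoc (winsIn L a) _ _ ⟨
    (winsIn L a + lossesIn L a) + sum (map (winsIn L) L)
      ≡⟨ cong₂ _+_ (winsIn+lossesIn a L a∉L) (sum-winsIn≡C2 L uniq) ⟩
    length L + length L C 2
      ≡⟨ cong (_+ length L C 2) (nC1≡n (length L)) ⟨
    length L C 1 + length L C 2
      ≡⟨ nCk+nC[k+1]≡[n+1]C[k+1] (length L) 1 ⟩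
    suc (length L) C 2
      ∎
    where open ≡-Reasoning

  score≤a⇒length≤2a+1 : ∀ {P : Pred (Fin m) ℓ} (P? : Decidable P) a → (∀ i → P i → score t i ≤ a) →
                        length (filter P? (allFin m)) ≤ 2 * a + 1
  score≤a⇒length≤2a+1 {P = P} P? a score≤a = nC2≤n*a⇒n≤2a+1 (length S) a (begin
    length S C 2           ≡⟨ sum-winsIn≡C2 S (Unique.filter⁺ P? (Unique.allFin⁺ m)) ⟨
    sum (map (winsIn S) S) ≤⟨ sum-map-≤-length (All.map winsIn≤a (all-filter P? (allFin m))) ⟩
    length S * a           ∎)
    where
    open ≤-Reasoning
    S = filter P? (allFin m)
    winsIn≤a : ∀ {i} → P i → winsIn S i ≤ a
    winsIn≤a {i} Pi = ≤-trans (winsIn-mono-⊆ i (filter-⊆ P? (allFin m))) (score≤a i Pi)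

strictMono⇒mono : ∀ {n} (α : Fin n → ℕ) → (∀ i j → i <ᶠ j → α i < α j) →
                  ∀ {i j} → i ≤ᶠ j → α i ≤ α j
strictMono⇒mono α α-strict {i} {j} i≤j with m≤n⇒m<n∨m≡n i≤j
... | inj₁ i<j = <⇒≤ (α-strict i j i<j)
... | inj₂ i≡j rewrite toℕ-injective i≡j = ≤-refl

module _ {n : ℕ} (α x : Fin n → ℕ) (k : Fin n) (α-mono : ∀ {i} → i ≤ᶠ k → α i ≤ α k) where

  p≤length-filter-≤α : p x k ≤ length (filter (_≤? α k) (expand α x))
  p≤length-filter-≤α = begin
    p x k
      ≤⟨ sum-map-mono-⊆ x (filter⁺ (λ i → toℕ i ≤? toℕ k) (λ i → α i ≤? α k)
                                   (λ { refl → α-mono }) (⊆-refl {x = allFin n})) ⟩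
    sum (map x (filter (λ i → α i ≤? α k) (allFin n)))
      ≡⟨ length-filter-concatMap-replicate (_≤? α k) α x (allFin n) ⟨
    length (filter (_≤? α k) (expand α x))
      ∎
    where open ≤-Reasoning

  q≤α*p : q α x k ≤ α k * p x k
  q≤α*p = sum-map-*-≤ α x (All.map α-mono (all-filter (λ i → toℕ i ≤? toℕ k) (allFin n)))

theorem3p1 : (n : ℕ) → 2 ≤ n → (α x : Fin n → ℕ) →
    (∀ (i j : Fin n) → i <ᶠ j → α i < α j) →
    (∀ (i : Fin n) → 1 ≤ x i) →
    IsScoreSequence (expand α x) →
    ∀ (k : Fin n) → (p x k ≤ 2 * α k + 1) × (q α x k ≤ α k * (2 * α k + 1))
-- The bounds hold without the hypotheses 2 ≤ n and 1 ≤ x i.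
theorem3p1 n _ α x α-strict _ (t , score≡s) k =
  p≤2αk+1 , ≤-trans (q≤α*p α x k α-mono) (*-monoʳ-≤ (α k) p≤2αk+1)
  where
  open ≤-Reasoning
  s = expand α x
  α-mono : ∀ {i} → i ≤ᶠ k → α i ≤ α k
  α-mono = strictMono⇒mono α α-strict
  p≤2αk+1 : p x k ≤ 2 * α k + 1
  p≤2αk+1 = begin
    p x k
      ≤⟨ p≤length-filter-≤α α x k α-mono ⟩
    length (filter (_≤? α k) s)
      ≡⟨ length-filter-lookup (_≤? α k) s ⟨
    length (filter (λ i → lookup s i ≤? α k) (allFin (length s)))
      ≤⟨ score≤a⇒length≤2a+1 t (λ i → lookup s i ≤? α k) (α k)
                             (λ i → subst (_≤ α k) (sym (score≡s i))) ⟩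
    2 * α k + 1
      ∎
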